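{- Let $n\geq 2$. Then $b_2(2n)\equiv 2\pmod 4$.
   Context: $\mathcal B(m)$ is the set of binary partitions of $m$ (all parts powers of $2$) and $m_\lambda(i)$ the number of parts of $\lambda$ equal to $i$. For $\lambda\in\mathcal B(m)$ let $h_{\mathcal B,\lambda}(x)=\prod_{i=0}^{\lfloor\log_2 m\rfloor}(1+x^{2^i})^{\lfloor m/2^i\rfloor-m_\lambda(2^i)}$ and $\mathrm{num}_{\mathcal B}(m,x)=\sum_{\lambda\in\mathcal B(m)}h_{\mathcal B,\lambda}(x)$. $b_2(m)$ denotes the coefficient of $x^2$ in $\mathrm{num}_{\mathcal B}(m,x)$. -}

module Defs where

open import Data.Nat using (ℕ; zero; suc; _+_; _*_; _∸_; _^_)
open import Data.Nat.DivMod using (_/_)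
open import Data.Nat.Properties using (m^n≢0)
open import Data.Nat.Logarithm using (⌊log₂_⌋)
open import Data.Fin using (Fin; toℕ)
open import Data.List using (List; []; _∷_; [_]; map; concatMap; upTo; replicate; _++_; foldr)
open import Data.Vec using (Vec; lookup; _∷ʳ_)
  renaming ([] to []ᵥ; _∷_ to _∷ᵥ_)

-- Polynomials with natural-number coefficients, as coefficient lists
-- (constant term first).

Poly : Set
Poly = List ℕ

infixl 6 _⊕_
infixl 7 _⊗_

_⊕_ : Poly → Poly → Poly
[] ⊕ q = q
(a ∷ p) ⊕ [] = a ∷ p
(a ∷ p) ⊕ (b ∷ q) = (a + b) ∷ (p ⊕ q)

_⊗_ : Poly → Poly → Poly
[] ⊗ q = []
(a ∷ p) ⊗ q = map (a *_) q ⊕ (0 ∷ (p ⊗ q))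

one : Poly
one = [ 1 ]

X^ : ℕ → Poly
X^ k = replicate k 0 ++ [ 1 ]

_^ₚ_ : Poly → ℕ → Poly
p ^ₚ zero = one
p ^ₚ suc e = p ⊗ (p ^ₚ e)

coeff : Poly → ℕ → ℕ
coeff [] k = 0
coeff (a ∷ p) zero = a
coeff (a ∷ p) (suc k) = coeff p k

prodFin : (n : ℕ) → (Fin n → Poly) → Poly
prodFin zero f = one
prodFin (suc n) f = f Fin.zero ⊗ prodFin n (λ i → f (Fin.suc i))

-- A binary partition λ of m (all parts powers of 2)
-- whose parts are at most 2^k is recorded by its multiplicity vector
-- (m_λ(2^0), …, m_λ(2^k)), i.e. position i holds m_λ(2^i), subject to
-- Σ_i m_λ(2^i) · 2^i = m.  'bparts k m' enumerates all such vectors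
-- (each exactly once): choose the multiplicity c of the largest part 2^k,
-- then recurse.

bparts : (k : ℕ) → ℕ → List (Vec ℕ (suc k))
bparts zero m = [ m ∷ᵥ []ᵥ ]
bparts (suc k) m =
  concatMap (λ c → map (λ v → v ∷ʳ c) (bparts k (m ∸ c * 2 ^ suc k)))
            (upTo (suc ((m / 2 ^ suc k) {{m^n≢0 2 (suc k)}})))

-- ℬ(m): all binary partitions of m (parts are ≤ m, so exponents
-- 0 … ⌊log₂ m⌋ suffice).
ℬ : (m : ℕ) → List (Vec ℕ (suc ⌊log₂ m ⌋))
ℬ m = bparts ⌊log₂ m ⌋ m

hℬ : (m : ℕ) → Vec ℕ (suc ⌊log₂ m ⌋) → Poly
hℬ m λ′ = prodFin (suc ⌊log₂ m ⌋)
  (λ i → (one ⊕ X^ (2 ^ toℕ i)) ^ₚ ((m / 2 ^ toℕ i) {{m^n≢0 2 (toℕ i)}} ∸ lookup λ′ i))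

numℬ : ℕ → Poly
numℬ m = foldr _⊕_ [] (map (hℬ m) (ℬ m))

b₂ : ℕ → ℕ
b₂ m = coeff (numℬ m) 2

{-# OPTIONS --safe #-}
module Submission where

-- Only the multiplicities m₁, m₂ of the parts 1 and 2 of λ enter the coefficient of x² in
-- h_{ℬ,λ}: it is C(2n − m₁, 2) + (n − m₂).  Pairing the 1s of a binary partition λ of 2n and
-- halving all parts gives a binary partition μ of n with p = m₁/2 + m₂ ones, and λ is recovered
-- from μ and m₂ ∈ [0, p].  Each of these p + 1 terms is ≡ 2n + 3p (mod 4), so
-- b₂(2n) ≡ Σ_μ (n · 2(p + 1) + 3 · p(p + 1)).
--
-- Over the binary partitions with parts ≤ 2^k of r = ρ + Q·2^(k+1), ρ < 2^(k+1), the sums of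
-- 2(p + 1) and of p(p + 1) are ≡ 2[ρ = 0] and ≡ 2Q + 2[ρ > 0] (mod 4).  This follows by
-- induction on k: removing the parts 2^k one at a time turns the sum at level k + 1 into the
-- sum of an arithmetic progression of sums at level k.  At r = n < 2^(k+1) it gives
-- b₂(2n) ≡ n · 0 + 3 · 2 ≡ 2.

open import Defs
open import Data.Fin as Fin using (Fin; toℕ)
open import Data.List using (List; []; _∷_; [_]; _++_; map; foldr; concatMap; applyUpTo; upTo)
open import Data.List.Properties using (map-++; map-∘; map-cong)
open import Data.Nat using (ℕ; zero; suc; _+_; _*_; _∸_; _^_; _≤_; _<_; _<?_; s≤s; z≤n; NonZero)
open import Data.Nat.Combinatorics using (_C_; nC1≡n; nCk+nC[k+1]≡[n+1]C[k+1])
open import Data.Nat.DivMod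
  using (_/_; _%_; n/1≡n; m*n/n≡m; m*n/m*o≡n/o; m<n⇒m/n≡0; m/n≡1+[m∸n]/n;
         %-distribˡ-+; %-distribˡ-*; [m+kn]%n≡m%n)
open import Data.Nat.ListAction using (sum)
open import Data.Nat.ListAction.Properties using (sum-++)
open import Data.Nat.Logarithm
  using (⌊log₂_⌋; ⌊log₂⌋-mono-≤; ⌊log₂[2^n]⌋≡n; ⌊log₂[2*b]⌋≡1+⌊log₂b⌋)
open import Data.Nat.Properties
open import Data.Nat.Tactic.RingSolver using (solve; solve-∀)
open import Data.Product using (_×_; _,_; ∃-syntax)
open import Data.Sum using (_⊎_; inj₁; inj₂)
open import Data.Vec using (Vec; head; lookup; _∷ʳ_) renaming ([] to []ᵥ; _∷_ to _∷ᵥ_)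
open import Function using (_∘_; id)
open import Level using (0ℓ)
open import Relation.Binary.Bundles using (Setoid)
open import Relation.Binary.PropositionalEquality
  using (_≡_; refl; sym; trans; cong; cong₂; subst; subst₂; module ≡-Reasoning)
import Relation.Binary.Reasoning.Setoid as SetoidReasoning
open import Relation.Nullary using (yes; no; contradiction)

-- Low-order coefficients of products

coeff-⊕ : ∀ p q k → coeff (p ⊕ q) k ≡ coeff p k + coeff q k
coeff-⊕ []      q       k       = refl
coeff-⊕ (a ∷ p) []      k       = sym (+-identityʳ _)
coeff-⊕ (a ∷ p) (b ∷ q) zero    = refl
coeff-⊕ (a ∷ p) (b ∷ q) (suc k) = coeff-⊕ p q k

coeff-map-* : ∀ a q k → coeff (map (a *_) q) k ≡ a * coeff q k
coeff-map-* a []      k       = sym (*-zeroʳ a)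
coeff-map-* a (b ∷ q) zero    = refl
coeff-map-* a (b ∷ q) (suc k) = coeff-map-* a q k

coeff-∷-⊗ : ∀ a p q k → coeff ((a ∷ p) ⊗ q) k ≡ a * coeff q k + coeff (0 ∷ p ⊗ q) k
coeff-∷-⊗ a p q k = trans (coeff-⊕ (map (a *_) q) (0 ∷ p ⊗ q) k)
                          (cong (_+ coeff (0 ∷ p ⊗ q) k) (coeff-map-* a q k))

coeff₀-⊗ : ∀ p q → coeff (p ⊗ q) 0 ≡ coeff p 0 * coeff q 0
coeff₀-⊗ []      q = refl
coeff₀-⊗ (a ∷ p) q = trans (coeff-∷-⊗ a p q 0) (+-identityʳ _)

coeff₁-⊗ : ∀ p q → coeff (p ⊗ q) 1 ≡ coeff p 0 * coeff q 1 + coeff p 1 * coeff q 0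
coeff₁-⊗ []      q = refl
coeff₁-⊗ (a ∷ p) q = trans (coeff-∷-⊗ a p q 1) (cong (a * coeff q 1 +_) (coeff₀-⊗ p q))

coeff₂-⊗ : ∀ p q →
  coeff (p ⊗ q) 2 ≡ coeff p 0 * coeff q 2 + coeff p 1 * coeff q 1 + coeff p 2 * coeff q 0
coeff₂-⊗ []      q = refl
coeff₂-⊗ (a ∷ p) q = trans (coeff-∷-⊗ a p q 2)
  (trans (cong (a * coeff q 2 +_) (coeff₁-⊗ p q)) (sym (+-assoc (a * coeff q 2) _ _)))

coeff-Σ : ∀ ps k → coeff (foldr _⊕_ [] ps) k ≡ sum (map (λ p → coeff p k) ps)
coeff-Σ []       k = refl
coeff-Σ (p ∷ ps) k = trans (coeff-⊕ p _ k) (cong (coeff p k +_) (coeff-Σ ps k))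

record LowTerms (p : Poly) (b c : ℕ) : Set where
  field
    coeff₀ : coeff p 0 ≡ 1
    coeff₁ : coeff p 1 ≡ b
    coeff₂ : coeff p 2 ≡ c

LowTerms-⊗ : ∀ {p q b c b′ c′} → LowTerms p b c → LowTerms q b′ c′ →
             LowTerms (p ⊗ q) (b + b′) (c + b * b′ + c′)
LowTerms-⊗ {p} {q} {b} {c} {b′} {c′} P Q = record
  { coeff₀ = trans (coeff₀-⊗ p q) (cong₂ _*_ P.coeff₀ Q.coeff₀)
  ; coeff₁ = pq₁
  ; coeff₂ = pq₂
  }
  where
  module P = LowTerms P
  module Q = LowTerms Q
  pq₁ : coeff (p ⊗ q) 1 ≡ b + b′
  pq₁ rewrite coeff₁-⊗ p q | P.coeff₀ | P.coeff₁ | Q.coeff₀ | Q.coeff₁ = solve (b ∷ b′ ∷ [])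
  pq₂ : coeff (p ⊗ q) 2 ≡ c + b * b′ + c′
  pq₂ rewrite coeff₂-⊗ p q | P.coeff₀ | P.coeff₁ | P.coeff₂ | Q.coeff₀ | Q.coeff₁ | Q.coeff₂ =
    solve (b ∷ c ∷ b′ ∷ c′ ∷ [])

LowTerms-one : LowTerms one 0 0
LowTerms-one = record { coeff₀ = refl ; coeff₁ = refl ; coeff₂ = refl }

[1+n]C2≡n+nC2 : ∀ n → suc n C 2 ≡ n + n C 2
[1+n]C2≡n+nC2 n = trans (sym (nCk+nC[k+1]≡[n+1]C[k+1] n 1)) (cong (_+ n C 2) (nC1≡n n))

LowTerms-^ₚ : ∀ {p b c} → LowTerms p b c → ∀ e →
              LowTerms (p ^ₚ e) (e * b) (e * c + (e C 2) * (b * b))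
LowTerms-^ₚ P zero    = LowTerms-one
LowTerms-^ₚ {p} {b} {c} P (suc e) =
  subst₂ (LowTerms (p ^ₚ suc e)) refl coefficient (LowTerms-⊗ P (LowTerms-^ₚ P e))
  where
  expand : ∀ b c e t → c + b * (e * b) + (e * c + t * (b * b)) ≡ suc e * c + (e + t) * (b * b)
  expand = solve-∀
  coefficient : c + b * (e * b) + (e * c + (e C 2) * (b * b)) ≡ suc e * c + (suc e C 2) * (b * b)
  coefficient = trans (expand b c e (e C 2))
                      (cong (λ t → suc e * c + t * (b * b)) (sym ([1+n]C2≡n+nC2 e)))

LowTerms-1+x : LowTerms (one ⊕ X^ 1) 1 0
LowTerms-1+x = record { coeff₀ = refl ; coeff₁ = refl ; coeff₂ = refl }

LowTerms-1+x² : LowTerms (one ⊕ X^ 2) 0 1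
LowTerms-1+x² = record { coeff₀ = refl ; coeff₁ = refl ; coeff₂ = refl }

LowTerms-[1+xᴺ]^ : ∀ {N} → 3 ≤ N → ∀ e → LowTerms ((one ⊕ X^ N) ^ₚ e) 0 0
LowTerms-[1+xᴺ]^ (s≤s (s≤s (s≤s _))) e =
  subst₂ (LowTerms _) (*-zeroʳ e) (cong₂ _+_ (*-zeroʳ e) (*-zeroʳ (e C 2)))
         (LowTerms-^ₚ (record { coeff₀ = refl ; coeff₁ = refl ; coeff₂ = refl }) e)

LowTerms-prodFin : ∀ K (F : Fin K → Poly) → (∀ i → LowTerms (F i) 0 0) → LowTerms (prodFin K F) 0 0
LowTerms-prodFin zero    F low = LowTerms-one
LowTerms-prodFin (suc K) F low =
  LowTerms-⊗ (low Fin.zero) (LowTerms-prodFin K (F ∘ Fin.suc) (low ∘ Fin.suc))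

3≤2^[2+n] : ∀ n → 3 ≤ 2 ^ (2 + n)
3≤2^[2+n] n = ≤-trans (s≤s (s≤s (s≤s z≤n))) (*-monoʳ-≤ 2 (*-monoʳ-≤ 2 (m^n>0 2 n)))

coeff₂-∏[1+x^2^i]^e : ∀ K (e : Fin (2 + K) → ℕ) →
  coeff (prodFin (2 + K) (λ i → (one ⊕ X^ (2 ^ toℕ i)) ^ₚ e i)) 2 ≡ e Fin.zero C 2 + e (Fin.suc Fin.zero)
coeff₂-∏[1+x^2^i]^e K e =
  trans (LowTerms.coeff₂ (LowTerms-⊗ (LowTerms-^ₚ LowTerms-1+x e₀)
                                     (LowTerms-⊗ (LowTerms-^ₚ LowTerms-1+x² e₁) higher)))
        (simplify e₀ e₁ (e₀ C 2) (e₁ C 2))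
  where
  e₀ e₁ : ℕ
  e₀ = e Fin.zero
  e₁ = e (Fin.suc Fin.zero)
  higher : LowTerms (prodFin K (λ i → (one ⊕ X^ (2 ^ (2 + toℕ i))) ^ₚ e (Fin.suc (Fin.suc i)))) 0 0
  higher = LowTerms-prodFin K _ (λ i → LowTerms-[1+xᴺ]^ (3≤2^[2+n] (toℕ i)) (e (Fin.suc (Fin.suc i))))
  simplify : ∀ a b t u →
    a * 0 + t * (1 * 1) + a * 1 * (b * 0 + 0) + (b * 1 + u * (0 * 0) + b * 0 * 0 + 0) ≡ t + b
  simplify = solve-∀

Σ≤ : ℕ → (ℕ → ℕ) → ℕ
Σ≤ zero    f = f 0
Σ≤ (suc q) f = f 0 + Σ≤ q (f ∘ suc)

syntax Σ≤ q (λ c → e) = Σ[ c ≤ q ] e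

Σ≤-cong : ∀ {f g : ℕ → ℕ} q → (∀ c → f c ≡ g c) → Σ≤ q f ≡ Σ≤ q g
Σ≤-cong zero    f≡g = f≡g 0
Σ≤-cong (suc q) f≡g = cong₂ _+_ (f≡g 0) (Σ≤-cong q (f≡g ∘ suc))

Σ≤-const : ∀ q x → Σ[ c ≤ q ] x ≡ suc q * x
Σ≤-const zero    x = sym (+-identityʳ x)
Σ≤-const (suc q) x = cong (x +_) (Σ≤-const q x)

sum-map-applyUpTo : ∀ (f g : ℕ → ℕ) q → sum (map f (applyUpTo g (suc q))) ≡ Σ≤ q (f ∘ g)
sum-map-applyUpTo f g zero    = +-identityʳ (f (g 0))
sum-map-applyUpTo f g (suc q) = cong (f (g 0) +_) (sum-map-applyUpTo f (g ∘ suc) q)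

sum-map-concatMap : ∀ {A B : Set} (g : B → ℕ) (h : A → List B) xs →
                    sum (map g (concatMap h xs)) ≡ sum (map (sum ∘ map g ∘ h) xs)
sum-map-concatMap g h []       = refl
sum-map-concatMap g h (x ∷ xs) = begin
  sum (map g (h x ++ concatMap h xs))                 ≡⟨ cong sum (map-++ g (h x) _) ⟩
  sum (map g (h x) ++ map g (concatMap h xs))         ≡⟨ sum-++ (map g (h x)) _ ⟩
  sum (map g (h x)) + sum (map g (concatMap h xs))    ≡⟨ cong (sum (map g (h x)) +_) (sum-map-concatMap g h xs) ⟩
  sum (map g (h x)) + sum (map (sum ∘ map g ∘ h) xs)  ∎
  where open ≡-Reasoning

sum-map-linear : ∀ {A : Set} a b (f g : A → ℕ) xs →
                 sum (map (λ x → a * f x + b * g x) xs) ≡ a * sum (map f xs) + b * sum (map g xs)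
sum-map-linear a b f g []       = sym (cong₂ _+_ (*-zeroʳ a) (*-zeroʳ b))
sum-map-linear a b f g (x ∷ xs) =
  trans (cong (a * f x + b * g x +_) (sum-map-linear a b f g xs))
        (distribute a b (f x) (g x) (sum (map f xs)) (sum (map g xs)))
  where
  distribute : ∀ a b x y X Y → a * x + b * y + (a * X + b * Y) ≡ a * (x + X) + b * (y + Y)
  distribute = solve-∀

module Congruence (d : ℕ) .{{_ : NonZero d}} where

  infix 4 _≈_
  record _≈_ (a b : ℕ) : Set where
    constructor reduce
    field %-≡ : a % d ≡ b % d
  open _≈_ public

  ≈-setoid : Setoid 0ℓ 0ℓ
  ≈-setoid = record
    { _≈_           = _≈_
    ; isEquivalence = record
      { refl  = reduce refl
      ; sym   = λ (reduce a≡b) → reduce (sym a≡b)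
      ; trans = λ (reduce a≡b) (reduce b≡c) → reduce (trans a≡b b≡c)
      }
    }

  module ≈-Reasoning = SetoidReasoning ≈-setoid

  +-cong : ∀ {a b c e} → a ≈ b → c ≈ e → a + c ≈ b + e
  +-cong {a} {b} {c} {e} (reduce a≡b) (reduce c≡e) = reduce (begin
    (a + c) % d           ≡⟨ %-distribˡ-+ a c d ⟩
    (a % d + c % d) % d   ≡⟨ cong₂ (λ x y → (x + y) % d) a≡b c≡e ⟩
    (b % d + e % d) % d   ≡⟨ %-distribˡ-+ b e d ⟨
    (b + e) % d           ∎)
    where open ≡-Reasoning

  *-congˡ : ∀ k {a b} → a ≈ b → k * a ≈ k * b
  *-congˡ k {a} {b} (reduce a≡b) = reduce (begin
    (k * a) % d             ≡⟨ %-distribˡ-* k a d ⟩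
    (k % d * (a % d)) % d   ≡⟨ cong (λ x → (k % d * x) % d) a≡b ⟩
    (k % d * (b % d)) % d   ≡⟨ %-distribˡ-* k b d ⟨
    (k * b) % d             ∎)
    where open ≡-Reasoning

  m+kd≈m : ∀ m k → m + k * d ≈ m
  m+kd≈m m k = reduce ([m+kn]%n≡m%n m k d)

  ≡+kd⇒≈ : ∀ {x y} k → x ≡ y + k * d → x ≈ y
  ≡+kd⇒≈ {y = y} k refl = m+kd≈m y k

  Σ≤-cong-≈ : ∀ {f g : ℕ → ℕ} q → (∀ {c} → c ≤ q → f c ≈ g c) → Σ≤ q f ≈ Σ≤ q g
  Σ≤-cong-≈ zero    f≈g = f≈g z≤n
  Σ≤-cong-≈ (suc q) f≈g = +-cong (f≈g z≤n) (Σ≤-cong-≈ q (f≈g ∘ s≤s))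

open Congruence 4

-- Sums over binary partitions

-- Instance search does not find NonZero (2 ^ k) on its own.
infixl 7 _/2^_
_/2^_ : ℕ → ℕ → ℕ
m /2^ k = (m / 2 ^ k) {{m^n≢0 2 k}}

Σ-bparts : (k : ℕ) → (Vec ℕ (suc k) → ℕ) → ℕ → ℕ
Σ-bparts k g m = sum (map g (bparts k m))

on-m₁-m₂ : ∀ {k} → (ℕ → ℕ → ℕ) → Vec ℕ (2 + k) → ℕ
on-m₁-m₂ g v = g (lookup v Fin.zero) (lookup v (Fin.suc Fin.zero))

head-∷ʳ : ∀ {k} (v : Vec ℕ (suc k)) c → head (v ∷ʳ c) ≡ head v
head-∷ʳ (x ∷ᵥ v) c = refl

on-m₁-m₂-∷ʳ : ∀ {k} g (v : Vec ℕ (2 + k)) c → on-m₁-m₂ g (v ∷ʳ c) ≡ on-m₁-m₂ g v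
on-m₁-m₂-∷ʳ g (x ∷ᵥ y ∷ᵥ v) c = refl

Σ-bparts-suc : ∀ k {g : Vec ℕ (2 + k) → ℕ} {g′ : Vec ℕ (suc k) → ℕ} →
  (∀ v c → g (v ∷ʳ c) ≡ g′ v) →
  ∀ m → Σ-bparts (suc k) g m ≡ Σ[ c ≤ m /2^ suc k ] Σ-bparts k g′ (m ∸ c * 2 ^ suc k)
Σ-bparts-suc k {g} {g′} g≡g′ m = begin
  Σ-bparts (suc k) g m                            ≡⟨ sum-map-concatMap g part (upTo (suc q)) ⟩
  sum (map (sum ∘ map g ∘ part) (upTo (suc q)))  ≡⟨ sum-map-applyUpTo (sum ∘ map g ∘ part) id q ⟩
  Σ≤ q (sum ∘ map g ∘ part)                       ≡⟨ Σ≤-cong q drop-last ⟩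
  Σ[ c ≤ q ] Σ-bparts k g′ (m ∸ c * 2 ^ suc k)    ∎
  where
  open ≡-Reasoning
  q = m /2^ suc k
  part : ℕ → List (Vec ℕ (2 + k))
  part c = map (_∷ʳ c) (bparts k (m ∸ c * 2 ^ suc k))
  drop-last : ∀ c → sum (map g (part c)) ≡ Σ-bparts k g′ (m ∸ c * 2 ^ suc k)
  drop-last c = cong sum (trans (sym (map-∘ (bparts k _))) (map-cong (λ v → g≡g′ v c) _))

Σ-bparts-suc-head : ∀ k (F : ℕ → ℕ) m →
  Σ-bparts (suc k) (F ∘ head) m ≡ Σ[ c ≤ m /2^ suc k ] Σ-bparts k (F ∘ head) (m ∸ c * 2 ^ suc k)
Σ-bparts-suc-head k F = Σ-bparts-suc k (λ v c → cong F (head-∷ʳ v c))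

Σ-bparts-one : ∀ (g : Vec ℕ 2 → ℕ) r →
  Σ-bparts 1 g r ≡ Σ[ c ≤ r / 2 ] g ((r ∸ c * 2) ∷ᵥ c ∷ᵥ []ᵥ)
Σ-bparts-one g r = begin
  Σ-bparts 1 g r                                  ≡⟨ sum-map-concatMap g singleton (upTo (suc (r / 2))) ⟩
  sum (map (sum ∘ map g ∘ singleton) (upTo (suc (r / 2))))
                                                  ≡⟨ sum-map-applyUpTo (sum ∘ map g ∘ singleton) id (r / 2) ⟩
  Σ≤ (r / 2) (sum ∘ map g ∘ singleton)            ≡⟨ Σ≤-cong (r / 2) (λ c → +-identityʳ _) ⟩
  Σ[ c ≤ r / 2 ] g ((r ∸ c * 2) ∷ᵥ c ∷ᵥ []ᵥ)     ∎
  where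
  open ≡-Reasoning
  singleton : ℕ → List (Vec ℕ 2)
  singleton c = [ (r ∸ c * 2) ∷ᵥ c ∷ᵥ []ᵥ ]

Σ-bparts-suc-< : ∀ k (F : ℕ → ℕ) {r} → r < 2 ^ suc k →
  Σ-bparts (suc k) (F ∘ head) r ≡ Σ-bparts k (F ∘ head) r
Σ-bparts-suc-< k F {r} r<M = begin
  Σ-bparts (suc k) (F ∘ head) r                                   ≡⟨ Σ-bparts-suc-head k F r ⟩
  Σ[ c ≤ r /2^ suc k ] Σ-bparts k (F ∘ head) (r ∸ c * 2 ^ suc k)
    ≡⟨ cong (λ q → Σ[ c ≤ q ] Σ-bparts k (F ∘ head) (r ∸ c * 2 ^ suc k))
            (m<n⇒m/n≡0 {{m^n≢0 2 (suc k)}} r<M) ⟩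
  Σ-bparts k (F ∘ head) r                                         ∎
  where open ≡-Reasoning

Σ-bparts-suc-+ : ∀ k (F : ℕ → ℕ) r → let M = 2 ^ suc k in
  Σ-bparts (suc k) (F ∘ head) (r + M) ≡ Σ-bparts k (F ∘ head) (r + M) + Σ-bparts (suc k) (F ∘ head) r
Σ-bparts-suc-+ k F r = begin
  Σ-bparts (suc k) (F ∘ head) (r + M)
    ≡⟨ Σ-bparts-suc-head k F (r + M) ⟩
  Σ[ c ≤ (r + M) /2^ suc k ] Σ-bparts k (F ∘ head) (r + M ∸ c * M)
    ≡⟨ cong (λ q → Σ[ c ≤ q ] Σ-bparts k (F ∘ head) (r + M ∸ c * M)) [r+M]/M≡1+r/M ⟩
  Σ-bparts k (F ∘ head) (r + M) + Σ[ c ≤ r /2^ suc k ] Σ-bparts k (F ∘ head) (r + M ∸ suc c * M)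
    ≡⟨ cong (Σ-bparts k (F ∘ head) (r + M) +_)
            (Σ≤-cong (r /2^ suc k) (cong (Σ-bparts k (F ∘ head)) ∘ cancel-M)) ⟩
  Σ-bparts k (F ∘ head) (r + M) + Σ[ c ≤ r /2^ suc k ] Σ-bparts k (F ∘ head) (r ∸ c * M)
    ≡⟨ cong (Σ-bparts k (F ∘ head) (r + M) +_) (Σ-bparts-suc-head k F r) ⟨
  Σ-bparts k (F ∘ head) (r + M) + Σ-bparts (suc k) (F ∘ head) r
    ∎
  where
  open ≡-Reasoning
  M = 2 ^ suc k
  [r+M]/M≡1+r/M : (r + M) /2^ suc k ≡ suc (r /2^ suc k)
  [r+M]/M≡1+r/M = trans (m/n≡1+[m∸n]/n {{m^n≢0 2 (suc k)}} (m≤n+m M r))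
                        (cong (λ x → suc (x /2^ suc k)) (m+n∸n≡m r M))
  cancel-M : ∀ c → r + M ∸ suc c * M ≡ r ∸ c * M
  cancel-M c = trans (cong (_∸ suc c * M) (+-comm r M)) ([m+n]∸[m+o]≡n∸o M r (c * M))

Σ-bparts-cong : ∀ k {F G : ℕ → ℕ} r → (∀ {p} → p ≤ r → F p ≈ G p) →
                Σ-bparts k (F ∘ head) r ≈ Σ-bparts k (G ∘ head) r
Σ-bparts-cong zero    r F≈G = +-cong (F≈G ≤-refl) (reduce refl)
Σ-bparts-cong (suc k) {F} {G} r F≈G = begin
  Σ-bparts (suc k) (F ∘ head) r                                   ≡⟨ Σ-bparts-suc-head k F r ⟩
  Σ[ c ≤ r /2^ suc k ] Σ-bparts k (F ∘ head) (r ∸ c * 2 ^ suc k)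
    ≈⟨ Σ≤-cong-≈ (r /2^ suc k) (λ {c} _ → Σ-bparts-cong k (r ∸ c * 2 ^ suc k)
                                            (λ p≤ → F≈G (≤-trans p≤ (m∸n≤m r (c * 2 ^ suc k))))) ⟩
  Σ[ c ≤ r /2^ suc k ] Σ-bparts k (G ∘ head) (r ∸ c * 2 ^ suc k)  ≡⟨ Σ-bparts-suc-head k G r ⟨
  Σ-bparts (suc k) (G ∘ head) r                                   ∎
  where open ≈-Reasoning

Σ-bparts-double : ∀ k (g : ℕ → ℕ → ℕ) m →
  Σ-bparts (suc k) (on-m₁-m₂ g) (2 * m) ≡ Σ-bparts k ((λ p → Σ-bparts 1 (on-m₁-m₂ g) (2 * p)) ∘ head) m
Σ-bparts-double zero    g m = sym (+-identityʳ _)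
Σ-bparts-double (suc k) g m = begin
  Σ-bparts (2 + k) (on-m₁-m₂ g) (2 * m)
    ≡⟨ Σ-bparts-suc (suc k) (on-m₁-m₂-∷ʳ g) (2 * m) ⟩
  Σ[ c ≤ (2 * m) /2^ (2 + k) ] Σ-bparts (suc k) (on-m₁-m₂ g) (2 * m ∸ c * (2 * M))
    ≡⟨ cong (λ q → Σ[ c ≤ q ] Σ-bparts (suc k) (on-m₁-m₂ g) (2 * m ∸ c * (2 * M))) halve ⟩
  Σ[ c ≤ m /2^ suc k ] Σ-bparts (suc k) (on-m₁-m₂ g) (2 * m ∸ c * (2 * M))
    ≡⟨ Σ≤-cong (m /2^ suc k) (λ c → trans (cong (Σ-bparts (suc k) (on-m₁-m₂ g)) (halve-∸ c))
                                          (Σ-bparts-double k g (m ∸ c * M))) ⟩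
  Σ[ c ≤ m /2^ suc k ] Σ-bparts k (Φ ∘ head) (m ∸ c * M)
    ≡⟨ Σ-bparts-suc-head k Φ m ⟨
  Σ-bparts (suc k) (Φ ∘ head) m
    ∎
  where
  open ≡-Reasoning
  M = 2 ^ suc k
  Φ : ℕ → ℕ
  Φ p = Σ-bparts 1 (on-m₁-m₂ g) (2 * p)
  halve : (2 * m) /2^ (2 + k) ≡ m /2^ suc k
  halve = m*n/m*o≡n/o 2 m M {{m^n≢0 2 (suc k)}} {{m^n≢0 2 (2 + k)}}
  *-comm-middle : ∀ a b c → a * (b * c) ≡ b * (a * c)
  *-comm-middle = solve-∀
  halve-∸ : ∀ c → 2 * m ∸ c * (2 * M) ≡ 2 * (m ∸ c * M)
  halve-∸ c = trans (cong (2 * m ∸_) (*-comm-middle c 2 M)) (sym (*-distribˡ-∸ 2 m (c * M)))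

-- Sums of 2(p + 1) and p(p + 1) modulo 4, p the number of parts 1

-- The sum at level k + 1 runs over the sums at level k at ρ + j·2^(k+1), j ≤ Q.
Σ-bparts-suc-progression : ∀ k (F : ℕ → ℕ) {ρ a b} → ρ < 2 ^ suc k →
  (∀ j → Σ-bparts k (F ∘ head) (ρ + j * 2 ^ suc k) ≈ 2 * b * j + a) →
  ∀ Q → Σ-bparts (suc k) (F ∘ head) (ρ + Q * 2 ^ suc k) ≈ suc Q * a + Q * suc Q * b
Σ-bparts-suc-progression k F {ρ} {a} {b} ρ<M linear zero = begin
  Σ-bparts (suc k) (F ∘ head) (ρ + 0)  ≡⟨ Σ-bparts-suc-< k F (subst (_< M) (sym (+-identityʳ ρ)) ρ<M) ⟩
  Σ-bparts k (F ∘ head) (ρ + 0)        ≈⟨ linear 0 ⟩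
  2 * b * 0 + a                        ≡⟨ simplify a b ⟩
  1 * a + 0 * 1 * b                    ∎
  where
  open ≈-Reasoning
  M = 2 ^ suc k
  simplify : ∀ a b → 2 * b * 0 + a ≡ 1 * a + 0 * 1 * b
  simplify = solve-∀
Σ-bparts-suc-progression k F {ρ} {a} {b} ρ<M linear (suc Q) = begin
  Σ-bparts (suc k) (F ∘ head) (ρ + suc Q * M)
    ≡⟨ cong (Σ-bparts (suc k) (F ∘ head)) (shift ρ Q M) ⟩
  Σ-bparts (suc k) (F ∘ head) (ρ + Q * M + M)
    ≡⟨ Σ-bparts-suc-+ k F (ρ + Q * M) ⟩
  Σ-bparts k (F ∘ head) (ρ + Q * M + M) + Σ-bparts (suc k) (F ∘ head) (ρ + Q * M)
    ≡⟨ cong (λ r → Σ-bparts k (F ∘ head) r + Σ-bparts (suc k) (F ∘ head) (ρ + Q * M)) (shift ρ Q M) ⟨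
  Σ-bparts k (F ∘ head) (ρ + suc Q * M) + Σ-bparts (suc k) (F ∘ head) (ρ + Q * M)
    ≈⟨ +-cong (linear (suc Q)) (Σ-bparts-suc-progression k F ρ<M linear Q) ⟩
  (2 * b * suc Q + a) + (suc Q * a + Q * suc Q * b)
    ≡⟨ collect a b Q ⟩
  suc (suc Q) * a + suc Q * suc (suc Q) * b
    ∎
  where
  open ≈-Reasoning
  M = 2 ^ suc k
  shift : ∀ ρ Q M → ρ + suc Q * M ≡ ρ + Q * M + M
  shift = solve-∀
  collect : ∀ a b Q →
    (2 * b * suc Q + a) + (suc Q * a + Q * suc Q * b) ≡ suc (suc Q) * a + suc Q * suc (suc Q) * b
  collect = solve-∀

m<2n⇒m<n⊎m≡o+n : ∀ {m n} → m < 2 * n → m < n ⊎ ∃[ o ] o < n × m ≡ o + n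
m<2n⇒m<n⊎m≡o+n {m} {n} m<2n with m <? n
... | yes m<n = inj₁ m<n
... | no  m≮n = inj₂ (m ∸ n , m∸n<n , sym (m∸n+n≡m n≤m))
  where
  n≤m : n ≤ m
  n≤m = ≮⇒≥ m≮n
  m∸n<n : m ∸ n < n
  m∸n<n = +-cancelʳ-< n (m ∸ n) n
            (subst₂ _<_ (sym (m∸n+n≡m n≤m)) (cong (n +_) (+-identityʳ n)) m<2n)

Affine : ℕ → (ℕ → ℕ) → ℕ → (ℕ → ℕ) → Set
Affine k F b s = ∀ Q {ρ} → ρ < 2 ^ suc k →
                 Σ-bparts k (F ∘ head) (ρ + Q * 2 ^ suc k) ≈ 2 * b * Q + 2 * s ρ

Affine-suc : ∀ k F {b s} → (∀ {x} → 0 < x → s x ≡ b) → Affine k F b s → Affine (suc k) F b s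
Affine-suc k F {b} {s} s>0≡b affine Q ρ′<2M = step (m<2n⇒m<n⊎m≡o+n ρ′<2M)
  where
  M = 2 ^ suc k
  progression : ∀ {ρ} → ρ < M → ∀ Q →
                Σ-bparts (suc k) (F ∘ head) (ρ + Q * M) ≈ suc Q * (2 * s ρ) + Q * suc Q * b
  progression ρ<M = Σ-bparts-suc-progression k F ρ<M (λ j → affine j ρ<M)
  -- ρ′ + Q·2M = ρ + Q′·M with ρ < M, where Q′ = 2Q if ρ′ < M and Q′ = 2Q + 1 otherwise.
  step : ∀ {ρ′} → ρ′ < M ⊎ ∃[ ρ ] ρ < M × ρ′ ≡ ρ + M →
         Σ-bparts (suc k) (F ∘ head) (ρ′ + Q * (2 * M)) ≈ 2 * b * Q + 2 * s ρ′
  step {ρ′} (inj₁ ρ′<M) = begin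
    Σ-bparts (suc k) (F ∘ head) (ρ′ + Q * (2 * M))
      ≡⟨ cong (Σ-bparts (suc k) (F ∘ head)) (even ρ′ Q M) ⟩
    Σ-bparts (suc k) (F ∘ head) (ρ′ + (2 * Q) * M)
      ≈⟨ progression ρ′<M (2 * Q) ⟩
    suc (2 * Q) * (2 * s ρ′) + 2 * Q * suc (2 * Q) * b
      ≡⟨ expand b Q (s ρ′) ⟩
    2 * b * Q + 2 * s ρ′ + (Q * s ρ′ + Q * Q * b) * 4
      ≈⟨ m+kd≈m (2 * b * Q + 2 * s ρ′) (Q * s ρ′ + Q * Q * b) ⟩
    2 * b * Q + 2 * s ρ′
      ∎
    where
    open ≈-Reasoning
    even : ∀ ρ Q M → ρ + Q * (2 * M) ≡ ρ + (2 * Q) * M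
    even = solve-∀
    expand : ∀ b Q t →
      suc (2 * Q) * (2 * t) + 2 * Q * suc (2 * Q) * b ≡ 2 * b * Q + 2 * t + (Q * t + Q * Q * b) * 4
    expand = solve-∀
  step (inj₂ (ρ , ρ<M , refl)) = begin
    Σ-bparts (suc k) (F ∘ head) (ρ + M + Q * (2 * M))
      ≡⟨ cong (Σ-bparts (suc k) (F ∘ head)) (odd ρ Q M) ⟩
    Σ-bparts (suc k) (F ∘ head) (ρ + suc (2 * Q) * M)
      ≈⟨ progression ρ<M (suc (2 * Q)) ⟩
    suc (suc (2 * Q)) * (2 * s ρ) + suc (2 * Q) * suc (suc (2 * Q)) * b
      ≡⟨ expand b Q (s ρ) ⟩
    2 * b * Q + 2 * b + (suc Q * s ρ + (Q * Q + Q) * b) * 4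
      ≈⟨ m+kd≈m (2 * b * Q + 2 * b) (suc Q * s ρ + (Q * Q + Q) * b) ⟩
    2 * b * Q + 2 * b
      ≡⟨ cong (λ x → 2 * b * Q + 2 * x) (s>0≡b (<-≤-trans (m^n>0 2 (suc k)) (m≤n+m M ρ))) ⟨
    2 * b * Q + 2 * s (ρ + M)
      ∎
    where
    open ≈-Reasoning
    odd : ∀ ρ Q M → ρ + M + Q * (2 * M) ≡ ρ + suc (2 * Q) * M
    odd = solve-∀
    expand : ∀ b Q t → suc (suc (2 * Q)) * (2 * t) + suc (2 * Q) * suc (suc (2 * Q)) * b
                       ≡ 2 * b * Q + 2 * b + (suc Q * t + (Q * Q + Q) * b) * 4
    expand = solve-∀

[_≡0] : ℕ → ℕ
[ zero  ≡0] = 1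
[ suc _ ≡0] = 0

[_>0] : ℕ → ℕ
[ zero  >0] = 0
[ suc _ >0] = 1

[x≡0]≡0 : ∀ {x} → 0 < x → [ x ≡0] ≡ 0
[x≡0]≡0 (s≤s _) = refl

[x>0]≡1 : ∀ {x} → 0 < x → [ x >0] ≡ 1
[x>0]≡1 (s≤s _) = refl

affine-2[1+p] : ∀ k → Affine k (λ p → 2 * suc p) 0 [_≡0]
affine-2[1+p] (suc k) = Affine-suc k (λ p → 2 * suc p) [x≡0]≡0 (affine-2[1+p] k)
affine-2[1+p] zero    = base
  where
  at-0 : ∀ Q → 2 * suc (Q * 2) + 0 ≡ 2 + Q * 4
  at-0 = solve-∀
  at-1 : ∀ Q → 2 * suc (1 + Q * 2) + 0 ≡ 0 + suc Q * 4
  at-1 = solve-∀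
  base : Affine 0 (λ p → 2 * suc p) 0 [_≡0]
  base Q {0}           _ = ≡+kd⇒≈ Q (at-0 Q)
  base Q {1}           _ = ≡+kd⇒≈ (suc Q) (at-1 Q)
  base Q {suc (suc _)} (s≤s (s≤s ()))

affine-p[1+p] : ∀ k → Affine k (λ p → p * suc p) 1 [_>0]
affine-p[1+p] (suc k) = Affine-suc k (λ p → p * suc p) [x>0]≡1 (affine-p[1+p] k)
affine-p[1+p] zero    = base
  where
  at-0 : ∀ Q → Q * 2 * suc (Q * 2) + 0 ≡ 2 * Q + 0 + Q * Q * 4
  at-0 = solve-∀
  at-1 : ∀ Q → suc (Q * 2) * suc (suc (Q * 2)) + 0 ≡ 2 * Q + 2 + (Q * Q + Q) * 4
  at-1 = solve-∀
  base : Affine 0 (λ p → p * suc p) 1 [_>0]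
  base Q {0}           _ = ≡+kd⇒≈ (Q * Q) (at-0 Q)
  base Q {1}           _ = ≡+kd⇒≈ (Q * Q + Q) (at-1 Q)
  base Q {suc (suc _)} (s≤s (s≤s ()))

-- The coefficient of x² in h_{ℬ,λ}

coeff₂-h : ℕ → ℕ → ℕ → ℕ
coeff₂-h m m₁ m₂ = (m ∸ m₁) C 2 + (m / 2 ∸ m₂)

b₂≡Σ-bparts : ∀ m K → ⌊log₂ m ⌋ ≡ suc K → b₂ m ≡ Σ-bparts (suc K) (on-m₁-m₂ (coeff₂-h m)) m
b₂≡Σ-bparts m K log≡ = trans (coeff-Σ (map (hℬ m) (ℬ m)) 2) (at-depth ⌊log₂ m ⌋ log≡)
  where
  h : ∀ L → Vec ℕ (suc L) → Poly
  h L v = prodFin (suc L) (λ i → (one ⊕ X^ (2 ^ toℕ i)) ^ₚ (m /2^ toℕ i ∸ lookup v i))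
  coeff₂-hᵥ : ∀ v → coeff (h (suc K) v) 2 ≡ on-m₁-m₂ (coeff₂-h m) v
  coeff₂-hᵥ v = trans (coeff₂-∏[1+x^2^i]^e K (λ i → m /2^ toℕ i ∸ lookup v i))
                      (cong (λ x → (x ∸ lookup v Fin.zero) C 2 + (m / 2 ∸ lookup v (Fin.suc Fin.zero)))
                            (n/1≡n m))
  -- ⌊log₂ m⌋ occurs in the type of hℬ m, so it has to be abstracted before matching on log≡.
  at-depth : ∀ L → L ≡ suc K →
    sum (map (λ p → coeff p 2) (map (h L) (bparts L m))) ≡ Σ-bparts (suc K) (on-m₁-m₂ (coeff₂-h m)) m
  at-depth .(suc K) refl =
    cong sum (trans (sym (map-∘ (bparts (suc K) m))) (map-cong coeff₂-hᵥ (bparts (suc K) m)))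

[2n]C2≡n+4·nC2 : ∀ n → (2 * n) C 2 ≡ n + (n C 2) * 4
[2n]C2≡n+4·nC2 zero    = refl
[2n]C2≡n+4·nC2 (suc n) = begin
  (2 * suc n) C 2                           ≡⟨ cong (_C 2) (*-suc 2 n) ⟩
  suc (suc (2 * n)) C 2                     ≡⟨ [1+n]C2≡n+nC2 (suc (2 * n)) ⟩
  suc (2 * n) + suc (2 * n) C 2             ≡⟨ cong (suc (2 * n) +_) ([1+n]C2≡n+nC2 (2 * n)) ⟩
  suc (2 * n) + (2 * n + (2 * n) C 2)       ≡⟨ cong (λ t → suc (2 * n) + (2 * n + t)) ([2n]C2≡n+4·nC2 n) ⟩
  suc (2 * n) + (2 * n + (n + (n C 2) * 4)) ≡⟨ regroup n (n C 2) ⟩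
  suc n + (n + n C 2) * 4                   ≡⟨ cong (λ t → suc n + t * 4) ([1+n]C2≡n+nC2 n) ⟨
  suc n + (suc n C 2) * 4                   ∎
  where
  open ≡-Reasoning
  regroup : ∀ n t → suc (2 * n) + (2 * n + (n + t * 4)) ≡ suc n + (n + t) * 4
  regroup = solve-∀

coeff₂-h-split : ∀ c e d →
  coeff₂-h (2 * (c + e + d)) (2 * (c + e) ∸ c * 2) c ≡ c + e + 2 * d + ((c + d) C 2) * 4
coeff₂-h-split c e d = begin
  (2 * (c + e + d) ∸ (2 * (c + e) ∸ c * 2)) C 2 + (2 * (c + e + d) / 2 ∸ c)
    ≡⟨ cong₂ (λ x y → x C 2 + y) m₁-term m₂-term ⟩
  (2 * (c + d)) C 2 + (e + d)
    ≡⟨ cong (_+ (e + d)) ([2n]C2≡n+4·nC2 (c + d)) ⟩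
  c + d + ((c + d) C 2) * 4 + (e + d)
    ≡⟨ regroup c d e ((c + d) C 2) ⟩
  c + e + 2 * d + ((c + d) C 2) * 4
    ∎
  where
  open ≡-Reasoning
  regroup : ∀ c d e t → c + d + t * 4 + (e + d) ≡ c + e + 2 * d + t * 4
  regroup = solve-∀
  m₁-term : 2 * (c + e + d) ∸ (2 * (c + e) ∸ c * 2) ≡ 2 * (c + d)
  m₁-term = begin
    2 * (c + e + d) ∸ (2 * (c + e) ∸ c * 2)
      ≡⟨ cong (λ x → 2 * (c + e + d) ∸ (x ∸ c * 2)) (solve (c ∷ e ∷ [])) ⟩
    2 * (c + e + d) ∸ (c * 2 + 2 * e ∸ c * 2)
      ≡⟨ cong (2 * (c + e + d) ∸_) (m+n∸m≡n (c * 2) (2 * e)) ⟩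
    2 * (c + e + d) ∸ 2 * e
      ≡⟨ cong (_∸ 2 * e) (solve (c ∷ e ∷ d ∷ [])) ⟩
    2 * e + 2 * (c + d) ∸ 2 * e
      ≡⟨ m+n∸m≡n (2 * e) (2 * (c + d)) ⟩
    2 * (c + d)
      ∎
  m₂-term : 2 * (c + e + d) / 2 ∸ c ≡ e + d
  m₂-term = begin
    2 * (c + e + d) / 2 ∸ c   ≡⟨ cong (λ x → x / 2 ∸ c) (*-comm 2 (c + e + d)) ⟩
    (c + e + d) * 2 / 2 ∸ c   ≡⟨ cong (_∸ c) (m*n/n≡m (c + e + d) 2) ⟩
    c + e + d ∸ c             ≡⟨ cong (_∸ c) (+-assoc c e d) ⟩
    c + (e + d) ∸ c           ≡⟨ m+n∸m≡n c (e + d) ⟩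
    e + d                     ∎

coeff₂-h-≈ : ∀ {n p c} → c ≤ p → p ≤ n → coeff₂-h (2 * n) (2 * p ∸ c * 2) c ≈ 2 * n + 3 * p
coeff₂-h-≈ {c = c} c≤p p≤n with m≤n⇒∃[o]m+o≡n c≤p | m≤n⇒∃[o]m+o≡n p≤n
... | e , refl | d , refl = begin
  coeff₂-h (2 * (c + e + d)) (2 * (c + e) ∸ c * 2) c  ≡⟨ coeff₂-h-split c e d ⟩
  c + e + 2 * d + ((c + d) C 2) * 4                  ≈⟨ m+kd≈m (c + e + 2 * d) ((c + d) C 2) ⟩
  c + e + 2 * d                                      ≈⟨ m+kd≈m (c + e + 2 * d) (c + e) ⟨
  c + e + 2 * d + (c + e) * 4                        ≡⟨ regroup c d e ⟩
  2 * (c + e + d) + 3 * (c + e)                      ∎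
  where
  open ≈-Reasoning
  regroup : ∀ c d e → c + e + 2 * d + (c + e) * 4 ≡ 2 * (c + e + d) + 3 * (c + e)
  regroup = solve-∀

Σ-bparts-one-coeff₂-h : ∀ {n p} → p ≤ n →
  Σ-bparts 1 (on-m₁-m₂ (coeff₂-h (2 * n))) (2 * p) ≈ n * (2 * suc p) + 3 * (p * suc p)
Σ-bparts-one-coeff₂-h {n} {p} p≤n = begin
  Σ-bparts 1 (on-m₁-m₂ (coeff₂-h (2 * n))) (2 * p)  ≡⟨ Σ-bparts-one (on-m₁-m₂ (coeff₂-h (2 * n))) (2 * p) ⟩
  Σ[ c ≤ 2 * p / 2 ] term c                          ≡⟨ cong (λ q → Σ[ c ≤ q ] term c) 2p/2≡p ⟩
  Σ[ c ≤ p ] term c                                  ≈⟨ Σ≤-cong-≈ p (λ c≤p → coeff₂-h-≈ c≤p p≤n) ⟩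
  Σ[ c ≤ p ] (2 * n + 3 * p)                         ≡⟨ Σ≤-const p (2 * n + 3 * p) ⟩
  suc p * (2 * n + 3 * p)                            ≡⟨ solve (n ∷ p ∷ []) ⟩
  n * (2 * suc p) + 3 * (p * suc p)                  ∎
  where
  open ≈-Reasoning
  term : ℕ → ℕ
  term c = coeff₂-h (2 * n) (2 * p ∸ c * 2) c
  2p/2≡p : 2 * p / 2 ≡ p
  2p/2≡p = trans (cong (_/ 2) (*-comm 2 p)) (m*n/n≡m p 2)

n<2^[1+⌊log₂n⌋] : ∀ n → n < 2 ^ suc ⌊log₂ n ⌋
n<2^[1+⌊log₂n⌋] n with n <? 2 ^ suc ⌊log₂ n ⌋
... | yes n<2^L = n<2^L
... | no  n≮2^L = contradiction
  (subst (_≤ ⌊log₂ n ⌋) (⌊log₂[2^n]⌋≡n (suc ⌊log₂ n ⌋)) (⌊log₂⌋-mono-≤ (≮⇒≥ n≮2^L)))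
  (n≮n ⌊log₂ n ⌋)

proposition4p10 : (n : ℕ) → 2 ≤ n → b₂ (2 * n) % 4 ≡ 2
proposition4p10 n (s≤s _) = %-≡ (begin   -- only n ≥ 1 is used
  b₂ (2 * n)
    ≡⟨ b₂≡Σ-bparts (2 * n) K (⌊log₂[2*b]⌋≡1+⌊log₂b⌋ n) ⟩
  Σ-bparts (suc K) (on-m₁-m₂ (coeff₂-h (2 * n))) (2 * n)
    ≡⟨ Σ-bparts-double K (coeff₂-h (2 * n)) n ⟩
  Σ-bparts K (Φ ∘ head) n
    ≈⟨ Σ-bparts-cong K n Σ-bparts-one-coeff₂-h ⟩
  Σ-bparts K (λ u → n * N (head u) + 3 * L (head u)) n
    ≡⟨ sum-map-linear n 3 (N ∘ head) (L ∘ head) (bparts K n) ⟩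
  n * Σ-bparts K (N ∘ head) n + 3 * Σ-bparts K (L ∘ head) n
    ≡⟨ cong (λ r → n * Σ-bparts K (N ∘ head) r + 3 * Σ-bparts K (L ∘ head) r) (+-identityʳ n) ⟨
  n * Σ-bparts K (N ∘ head) (n + 0) + 3 * Σ-bparts K (L ∘ head) (n + 0)
    ≈⟨ +-cong (*-congˡ n (affine-2[1+p] K 0 n<2^[1+K])) (*-congˡ 3 (affine-p[1+p] K 0 n<2^[1+K])) ⟩
  n * 0 + 6
    ≡⟨ cong (_+ 6) (*-zeroʳ n) ⟩
  6
    ≈⟨ m+kd≈m 2 1 ⟩
  2 ∎)
  where
  open ≈-Reasoning
  K : ℕ
  K = ⌊log₂ n ⌋
  n<2^[1+K] : n < 2 ^ suc K
  n<2^[1+K] = n<2^[1+⌊log₂n⌋] n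
  N L Φ : ℕ → ℕ
  N p = 2 * suc p
  L p = p * suc p
  Φ p = Σ-bparts 1 (on-m₁-m₂ (coeff₂-h (2 * n))) (2 * p)
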